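{- For every integer $k\geq 1$, with $f_{2^k,n}:=\sum_{j=0}^{n}\binom{n}{j}(-1)^{\binom{j}{2^k}}$, we have \[\sum_{n=0}^{\infty}f_{2^k,n}\left(\tfrac{1}{2}\right)^n=2^k.\]
   Context: Here $\binom{j}{m}=0$ for $0\le j<m$; $f_{2^k,n}$ is the value at $z=-1$ of $f_{2^k,n}(z)=\sum_{j=0}^{n}\binom{n}{j}z^{\binom{j}{2^k}}$. -}

module Defs where

open import Data.Nat as ℕ using (ℕ; zero; suc; _≥_)
open import Data.Nat.Combinatorics using (_C_)
open import Data.Integer as ℤ using (ℤ; -1ℤ; +_)
open import Data.Rational as ℚ using (ℚ; 0ℚ; 1ℚ; ½; _/_)
open import Data.Product using (∃-syntax)

sumTo : ℕ → (ℕ → ℤ) → ℤ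
sumTo zero    g = g zero
sumTo (suc n) g = sumTo n g ℤ.+ g (suc n)

f : ℕ → ℕ → ℤ
f m n = sumTo n (λ j → (+ (n C j)) ℤ.* (-1ℤ ℤ.^ (j C m)))

halfPow : ℕ → ℚ
halfPow zero    = 1ℚ
halfPow (suc n) = ½ ℚ.* halfPow n

toℚ : ℤ → ℚ
toℚ z = z / 1

partialSum : (ℕ → ℚ) → ℕ → ℚ
partialSum a zero    = a zero
partialSum a (suc N) = partialSum a N ℚ.+ a (suc N)

SeriesSumsTo : (ℕ → ℚ) → ℚ → Set
SeriesSumsTo a L =
  ∀ (ε : ℚ) → 0ℚ ℚ.< ε → ∃[ N ] (∀ M → M ≥ N → ℚ.∣ partialSum a M ℚ.- L ∣ ℚ.< ε)

{-# OPTIONS --safe #-}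
-- Let K = 2^k with k ≥ 1 and g(j) = (-1)^C(j,K). Lucas' theorem gives (-1)^C(j,K) = (-1)^⌊j/K⌋,
-- so g(j + K) = -g(j). Writing (Pφ)(t) = φ(t) + φ(t+1), f_{K,n} = (Pⁿg)(0), and summation by
-- parts shows that 2^N times the N-th partial sum equals (P^{N+1}G)(0) for the cumulative sums G
-- of g. Now G(t + K) = K - G(t), so H = G - K/2 is K-antiperiodic: it is bounded and its sums
-- over any 2K consecutive values vanish; the constant K/2 contributes exactly 2^N K.
-- For L + 1 = 2K, (P^L H)(t) = Σ C(L,j) H(t+j) = Σ (C(L,j) - 1) H(t+j), so each block of L
-- pairings multiplies the bound on H by at most 2^L - L - 1 < 2^L. Hence (P^{N+1}H)(0) = o(2^N)
-- and the partial sums tend to K.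
module Submission where

open import Data.Nat as ℕ using (ℕ; zero; suc; _+_; _*_; _^_; _∸_; _≤_; _<_; _≥_; z≤n; s≤s; NonZero)
import Data.Nat.Properties as ℕP
import Data.Nat.Tactic.RingSolver as ℕSolver
open import Data.Nat.Combinatorics using (_C_; nC1≡n; nCk+nC[k+1]≡[n+1]C[k+1])
open import Data.Nat.Combinatorics.Specification using (k>n⇒nCk≡0)
open import Data.Nat.DivMod using (_/_; _%_; m≡m%n+[m/n]*n; m%n<n; m*n/n≡m; /-monoˡ-≤)
open import Data.Integer as ℤ using (ℤ; +_; 0ℤ; 1ℤ; -1ℤ)
import Data.Integer.Properties as ℤP
import Data.Integer.Tactic.RingSolver as ℤSolver
open import Data.Rational as ℚ using (ℚ; toℚᵘ)
import Data.Rational.Properties as ℚP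
open import Data.Rational.Unnormalised as ℚᵘ using (mkℚᵘ; *≡*; _≃_)
import Data.Rational.Unnormalised.Properties as ℚᵘP
open import Data.Product using (∃-syntax; _,_; proj₁; proj₂)
open import Relation.Binary.PropositionalEquality
open ≡-Reasoning

open import Defs

-- Parity of binomial coefficients

sign : ℕ → ℤ
sign n = -1ℤ ℤ.^ n

sign-+ : ∀ m n → sign (m + n) ≡ sign m ℤ.* sign n
sign-+ = ℤP.^-distribˡ-+-* -1ℤ

sign-suc : ∀ n → sign (suc n) ≡ ℤ.- sign n
sign-suc n = ℤP.-1*i≡-i (sign n)

sign-suc-suc : ∀ n → sign (suc (suc n)) ≡ sign n
sign-suc-suc n = begin
  sign (suc (suc n))    ≡⟨ sign-suc (suc n) ⟩
  ℤ.- sign (suc n)      ≡⟨ cong ℤ.-_ (sign-suc n) ⟩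
  ℤ.- (ℤ.- sign n)      ≡⟨ ℤP.neg-involutive (sign n) ⟩
  sign n                ∎

double-suc : ∀ n → suc n + suc n ≡ suc (suc (n + n))
double-suc n = cong suc (ℕP.+-suc n n)

sign-double : ∀ n → sign (n + n) ≡ 1ℤ
sign-double zero    = refl
sign-double (suc n) = begin
  sign (suc n + suc n)      ≡⟨ cong sign (double-suc n) ⟩
  sign (suc (suc (n + n)))  ≡⟨ sign-suc-suc (n + n) ⟩
  sign (n + n)              ≡⟨ sign-double n ⟩
  1ℤ                        ∎

pascal : ∀ n k → suc n C suc k ≡ n C k + n C suc k
pascal n k = sym (nCk+nC[k+1]≡[n+1]C[k+1] n k)

-- Pascal twice: C(n+2,j+2) = C(n,j) + 2 C(n,j+1) + C(n,j+2).
sign-C-suc-suc : ∀ n j → sign (suc (suc n) C suc (suc j)) ≡ sign (n C j) ℤ.* sign (n C suc (suc j))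
sign-C-suc-suc n j = begin
  sign (suc (suc n) C suc (suc j))
    ≡⟨ cong sign (trans (pascal (suc n) (suc j)) (cong₂ _+_ (pascal n j) (pascal n (suc j)))) ⟩
  sign ((a + b) + (b + c))      ≡⟨ cong sign (regroup a b c) ⟩
  sign ((b + b) + (a + c))      ≡⟨ sign-+ (b + b) (a + c) ⟩
  sign (b + b) ℤ.* sign (a + c) ≡⟨ cong₂ ℤ._*_ (sign-double b) (sign-+ a c) ⟩
  1ℤ ℤ.* (sign a ℤ.* sign c)    ≡⟨ ℤP.*-identityˡ _ ⟩
  sign a ℤ.* sign c             ∎
  where
  a = n C j
  b = n C suc j
  c = n C suc (suc j)
  regroup : ∀ a b c → (a + b) + (b + c) ≡ (b + b) + (a + c)
  regroup = ℕSolver.solve-∀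

sign-C-even-odd : ∀ x m → sign ((x + x) C suc (m + m)) ≡ 1ℤ
sign-C-even-odd zero    m       = refl
sign-C-even-odd (suc x) zero    = trans (cong sign (nC1≡n (suc x + suc x))) (sign-double (suc x))
sign-C-even-odd (suc x) (suc m) = begin
  sign ((suc x + suc x) C suc (suc m + suc m))
    ≡⟨ cong₂ (λ n j → sign (n C suc j)) (double-suc x) (double-suc m) ⟩
  sign (suc (suc (x + x)) C suc (suc (suc (m + m))))
    ≡⟨ sign-C-suc-suc (x + x) (suc (m + m)) ⟩
  sign ((x + x) C suc (m + m)) ℤ.* sign ((x + x) C suc (suc (suc (m + m))))
    ≡⟨ cong₂ ℤ._*_ (sign-C-even-odd x m)
         (trans (cong (λ j → sign ((x + x) C suc j)) (sym (double-suc m))) (sign-C-even-odd x (suc m))) ⟩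
  1ℤ ∎

sign-C-even-even : ∀ x m → sign ((x + x) C (m + m)) ≡ sign (x C m)
sign-C-even-even x       zero    = refl
sign-C-even-even zero    (suc m) = refl
sign-C-even-even (suc x) (suc m) = begin
  sign ((suc x + suc x) C (suc m + suc m))
    ≡⟨ cong₂ (λ n j → sign (n C j)) (double-suc x) (double-suc m) ⟩
  sign (suc (suc (x + x)) C suc (suc (m + m)))
    ≡⟨ sign-C-suc-suc (x + x) (m + m) ⟩
  sign ((x + x) C (m + m)) ℤ.* sign ((x + x) C suc (suc (m + m)))
    ≡⟨ cong₂ ℤ._*_ (sign-C-even-even x m)
         (trans (cong (λ j → sign ((x + x) C j)) (sym (double-suc m))) (sign-C-even-even x (suc m))) ⟩
  sign (x C m) ℤ.* sign (x C suc m)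
    ≡⟨ sym (sign-+ (x C m) (x C suc m)) ⟩
  sign (x C m + x C suc m)
    ≡⟨ cong sign (sym (pascal x m)) ⟩
  sign (suc x C suc m) ∎

sign-C-odd-even : ∀ x m → sign (suc (x + x) C (m + m)) ≡ sign (x C m)
sign-C-odd-even x zero    = refl
sign-C-odd-even x (suc m) = begin
  sign (suc (x + x) C (suc m + suc m))
    ≡⟨ cong (λ j → sign (suc (x + x) C j)) (double-suc m) ⟩
  sign (suc (x + x) C suc (suc (m + m)))
    ≡⟨ cong sign (pascal (x + x) (suc (m + m))) ⟩
  sign ((x + x) C suc (m + m) + (x + x) C suc (suc (m + m)))
    ≡⟨ sign-+ ((x + x) C suc (m + m)) ((x + x) C suc (suc (m + m))) ⟩
  sign ((x + x) C suc (m + m)) ℤ.* sign ((x + x) C suc (suc (m + m)))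
    ≡⟨ cong₂ ℤ._*_ (sign-C-even-odd x m)
         (trans (cong (λ j → sign ((x + x) C j)) (sym (double-suc m))) (sign-C-even-even x (suc m))) ⟩
  1ℤ ℤ.* sign (x C suc m)
    ≡⟨ ℤP.*-identityˡ _ ⟩
  sign (x C suc m) ∎

data Parity : ℕ → Set where
  even : ∀ x → Parity (x + x)
  odd  : ∀ x → Parity (suc (x + x))

parity : ∀ n → Parity n
parity zero = even 0
parity (suc n) with parity n
... | even x = odd x
... | odd x  = subst Parity (double-suc x) (even (suc x))

half-< : ∀ {x y} → x + x < y + y → x < y
half-< lt = ℕP.≰⇒> (λ y≤x → ℕP.<⇒≱ lt (ℕP.+-mono-≤ y≤x y≤x))

2^[1+k]≡2^k+2^k : ∀ k → 2 ^ suc k ≡ 2 ^ k + 2 ^ k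
2^[1+k]≡2^k+2^k k = cong (λ n → 2 ^ k + n) (ℕP.+-identityʳ (2 ^ k))

x+x+q*[2K]≡[x+qK]+[x+qK] : ∀ x q K → x + x + q * (2 * K) ≡ (x + q * K) + (x + q * K)
x+x+q*[2K]≡[x+qK]+[x+qK] = ℕSolver.solve-∀

sign-C-2^ : ∀ k q r → r < 2 ^ k → sign ((r + q * 2 ^ k) C 2 ^ k) ≡ sign q
sign-C-2^ zero    q zero    _         = cong sign (trans (nC1≡n (q * 1)) (ℕP.*-identityʳ q))
sign-C-2^ zero    q (suc r) (s≤s ())
sign-C-2^ (suc k) q r       r<2^[1+k] with parity r
... | even x = begin
  sign ((x + x + q * 2 ^ suc k) C 2 ^ suc k)
    ≡⟨ cong₂ (λ n j → sign (n C j)) (x+x+q*[2K]≡[x+qK]+[x+qK] x q (2 ^ k)) (2^[1+k]≡2^k+2^k k) ⟩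
  sign (((x + q * 2 ^ k) + (x + q * 2 ^ k)) C (2 ^ k + 2 ^ k))
    ≡⟨ sign-C-even-even (x + q * 2 ^ k) (2 ^ k) ⟩
  sign ((x + q * 2 ^ k) C 2 ^ k)
    ≡⟨ sign-C-2^ k q x (half-< (subst (x + x <_) (2^[1+k]≡2^k+2^k k) r<2^[1+k])) ⟩
  sign q ∎
... | odd x = begin
  sign ((suc (x + x) + q * 2 ^ suc k) C 2 ^ suc k)
    ≡⟨ cong₂ (λ n j → sign (suc n C j)) (x+x+q*[2K]≡[x+qK]+[x+qK] x q (2 ^ k)) (2^[1+k]≡2^k+2^k k) ⟩
  sign (suc ((x + q * 2 ^ k) + (x + q * 2 ^ k)) C (2 ^ k + 2 ^ k))
    ≡⟨ sign-C-odd-even (x + q * 2 ^ k) (2 ^ k) ⟩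
  sign ((x + q * 2 ^ k) C 2 ^ k)
    ≡⟨ sign-C-2^ k q x (half-< (subst (x + x <_) (2^[1+k]≡2^k+2^k k) (ℕP.<⇒≤ r<2^[1+k]))) ⟩
  sign q ∎

sign-C-2^-below : ∀ k r → r < 2 ^ k → sign (r C 2 ^ k) ≡ 1ℤ
sign-C-2^-below k r r<2^k =
  trans (cong (λ n → sign (n C 2 ^ k)) (sym (ℕP.+-identityʳ r))) (sign-C-2^ k 0 r r<2^k)

Antiperiodic : ℕ → (ℕ → ℤ) → Set
Antiperiodic K ψ = ∀ t → ψ (t + K) ≡ ℤ.- ψ t

sign-C-2^-antiperiodic : ∀ k → Antiperiodic (2 ^ k) (λ j → sign (j C 2 ^ k))
sign-C-2^-antiperiodic k t = begin
  sign ((t + K) C K)          ≡⟨ cong (λ n → sign ((n + K) C K)) t≡r+q*K ⟩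
  sign ((r + q * K + K) C K)  ≡⟨ cong (λ n → sign (n C K)) (regroup r q K) ⟩
  sign ((r + suc q * K) C K)  ≡⟨ sign-C-2^ k (suc q) r r<K ⟩
  sign (suc q)                ≡⟨ sign-suc q ⟩
  ℤ.- sign q                  ≡⟨ cong ℤ.-_ (sym (sign-C-2^ k q r r<K)) ⟩
  ℤ.- sign ((r + q * K) C K)  ≡⟨ cong (λ n → ℤ.- sign (n C K)) (sym t≡r+q*K) ⟩
  ℤ.- sign (t C K)            ∎
  where
  K = 2 ^ k
  instance _ = ℕP.m^n≢0 2 k
  q = t / K
  r = t % K
  r<K = m%n<n t K
  t≡r+q*K = m≡m%n+[m/n]*n t K
  regroup : ∀ r q K → r + q * K + K ≡ r + suc q * K
  regroup = ℕSolver.solve-∀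

-- Finite sums and antiperiodic functions

sumBelow : ℕ → (ℕ → ℤ) → ℤ
sumBelow zero    φ = 0ℤ
sumBelow (suc n) φ = sumBelow n φ ℤ.+ φ n

sumTo≡sumBelow : ∀ n φ → sumTo n φ ≡ sumBelow (suc n) φ
sumTo≡sumBelow zero    φ = sym (ℤP.+-identityˡ (φ 0))
sumTo≡sumBelow (suc n) φ = cong (ℤ._+ φ (suc n)) (sumTo≡sumBelow n φ)

sumBelow-cong : ∀ n {φ ψ} → (∀ i → i < n → φ i ≡ ψ i) → sumBelow n φ ≡ sumBelow n ψ
sumBelow-cong zero    eq = refl
sumBelow-cong (suc n) eq =
  cong₂ ℤ._+_ (sumBelow-cong n (λ i i<n → eq i (ℕP.m<n⇒m<1+n i<n))) (eq n (ℕP.n<1+n n))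

sumBelow-+ : ∀ n φ ψ → sumBelow n (λ i → φ i ℤ.+ ψ i) ≡ sumBelow n φ ℤ.+ sumBelow n ψ
sumBelow-+ zero    φ ψ = refl
sumBelow-+ (suc n) φ ψ = trans (cong (ℤ._+ (φ n ℤ.+ ψ n)) (sumBelow-+ n φ ψ)) (interchange (sumBelow n φ) (sumBelow n ψ) (φ n) (ψ n))
  where
  interchange : ∀ a b c d → (a ℤ.+ b) ℤ.+ (c ℤ.+ d) ≡ (a ℤ.+ c) ℤ.+ (b ℤ.+ d)
  interchange = ℤSolver.solve-∀

sumBelow-neg : ∀ n φ → sumBelow n (λ i → ℤ.- φ i) ≡ ℤ.- sumBelow n φ
sumBelow-neg zero    φ = refl
sumBelow-neg (suc n) φ =
  trans (cong (ℤ._+ ℤ.- φ n) (sumBelow-neg n φ)) (sym (ℤP.neg-distrib-+ (sumBelow n φ) (φ n)))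

sumBelow-split : ∀ m n φ → sumBelow (m + n) φ ≡ sumBelow m φ ℤ.+ sumBelow n (λ i → φ (m + i))
sumBelow-split m zero    φ = trans (cong (λ k → sumBelow k φ) (ℕP.+-identityʳ m)) (sym (ℤP.+-identityʳ _))
sumBelow-split m (suc n) φ = begin
  sumBelow (m + suc n) φ                                     ≡⟨ cong (λ k → sumBelow k φ) (ℕP.+-suc m n) ⟩
  sumBelow (m + n) φ ℤ.+ φ (m + n)                           ≡⟨ cong (ℤ._+ φ (m + n)) (sumBelow-split m n φ) ⟩
  sumBelow m φ ℤ.+ sumBelow n (λ i → φ (m + i)) ℤ.+ φ (m + n) ≡⟨ ℤP.+-assoc (sumBelow m φ) (sumBelow n (λ i → φ (m + i))) (φ (m + n)) ⟩
  sumBelow m φ ℤ.+ sumBelow (suc n) (λ i → φ (m + i))        ∎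

sumBelow-suc : ∀ n φ → sumBelow (suc n) φ ≡ φ 0 ℤ.+ sumBelow n (λ i → φ (suc i))
sumBelow-suc n φ = trans (sumBelow-split 1 n φ) (cong (ℤ._+ sumBelow n (λ i → φ (suc i))) (ℤP.+-identityˡ (φ 0)))

sumBelow-ones : ∀ n φ → (∀ i → i < n → φ i ≡ 1ℤ) → sumBelow n φ ≡ + n
sumBelow-ones zero    φ ones = refl
sumBelow-ones (suc n) φ ones = begin
  sumBelow n φ ℤ.+ φ n ≡⟨ cong₂ ℤ._+_ (sumBelow-ones n φ (λ i i<n → ones i (ℕP.m<n⇒m<1+n i<n))) (ones n (ℕP.n<1+n n)) ⟩
  + n ℤ.+ 1ℤ           ≡⟨ sym (ℤP.pos-+ n 1) ⟩
  + (n + 1)            ≡⟨ cong +_ (ℕP.+-comm n 1) ⟩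
  + suc n              ∎

sumBelow-antiperiodic : ∀ K φ → Antiperiodic K φ → ∀ t → sumBelow (t + K) φ ≡ sumBelow K φ ℤ.- sumBelow t φ
sumBelow-antiperiodic K φ anti zero    = sym (ℤP.+-identityʳ (sumBelow K φ))
sumBelow-antiperiodic K φ anti (suc t) = begin
  sumBelow (t + K) φ ℤ.+ φ (t + K)                           ≡⟨ cong₂ ℤ._+_ (sumBelow-antiperiodic K φ anti t) (anti t) ⟩
  (sumBelow K φ ℤ.- sumBelow t φ) ℤ.+ ℤ.- φ t                ≡⟨ regroup (sumBelow K φ) (sumBelow t φ) (φ t) ⟩
  sumBelow K φ ℤ.- sumBelow (suc t) φ                        ∎
  where
  regroup : ∀ a b c → (a ℤ.- b) ℤ.+ ℤ.- c ≡ a ℤ.- (b ℤ.+ c)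
  regroup = ℤSolver.solve-∀

ZeroWindowSums : ℕ → (ℕ → ℤ) → Set
ZeroWindowSums n ψ = ∀ t → sumBelow n (λ i → ψ (t + i)) ≡ 0ℤ

antiperiodic⇒zeroWindowSums : ∀ K ψ → Antiperiodic K ψ → ZeroWindowSums (K + K) ψ
antiperiodic⇒zeroWindowSums K ψ anti t = begin
  sumBelow (K + K) (λ i → ψ (t + i))                                ≡⟨ sumBelow-split K K _ ⟩
  window ℤ.+ sumBelow K (λ i → ψ (t + (K + i)))                     ≡⟨ cong (ℤ._+_ window) (sumBelow-cong K second-half) ⟩
  window ℤ.+ sumBelow K (λ i → ℤ.- ψ (t + i))                       ≡⟨ cong (ℤ._+_ window) (sumBelow-neg K _) ⟩
  window ℤ.+ ℤ.- window                                             ≡⟨ ℤP.+-inverseʳ window ⟩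
  0ℤ                                                                ∎
  where
  window = sumBelow K (λ i → ψ (t + i))
  second-half : ∀ i → i < K → ψ (t + (K + i)) ≡ ℤ.- ψ (t + i)
  second-half i _ = trans (cong ψ (regroup t K i)) (anti (t + i))
    where
    regroup : ∀ t K i → t + (K + i) ≡ t + i + K
    regroup = ℕSolver.solve-∀

Bounded : ℕ → (ℕ → ℤ) → Set
Bounded m ψ = ∀ t → ℤ.∣ ψ t ∣ ≤ m

antiperiodic-bounded : ∀ K .{{_ : NonZero K}} ψ m → Antiperiodic K ψ →
                       (∀ r → r < K → ℤ.∣ ψ r ∣ ≤ m) → Bounded m ψ
antiperiodic-bounded K ψ m anti bound t =
  subst (λ n → ℤ.∣ ψ n ∣ ≤ m) (sym (m≡m%n+[m/n]*n t K))
    (subst (_≤ m) (sym (∣ψ∣-periodic (t / K) (t % K))) (bound (t % K) (m%n<n t K)))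
  where
  ∣ψ∣-periodic : ∀ q r → ℤ.∣ ψ (r + q * K) ∣ ≡ ℤ.∣ ψ r ∣
  ∣ψ∣-periodic zero    r = cong (λ n → ℤ.∣ ψ n ∣) (ℕP.+-identityʳ r)
  ∣ψ∣-periodic (suc q) r = begin
    ℤ.∣ ψ (r + suc q * K) ∣   ≡⟨ cong (λ n → ℤ.∣ ψ n ∣) (regroup r q K) ⟩
    ℤ.∣ ψ (r + q * K + K) ∣   ≡⟨ cong ℤ.∣_∣ (anti (r + q * K)) ⟩
    ℤ.∣ ℤ.- ψ (r + q * K) ∣   ≡⟨ ℤP.∣-i∣≡∣i∣ (ψ (r + q * K)) ⟩
    ℤ.∣ ψ (r + q * K) ∣       ≡⟨ ∣ψ∣-periodic q r ⟩
    ℤ.∣ ψ r ∣                 ∎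
    where
    regroup : ∀ r q K → r + suc q * K ≡ r + q * K + K
    regroup = ℕSolver.solve-∀

-- Iterated pairing and binomial sums

pairSum : (ℕ → ℤ) → ℕ → ℤ
pairSum φ t = φ t ℤ.+ φ (suc t)

pairSum^ : ℕ → (ℕ → ℤ) → ℕ → ℤ
pairSum^ zero    φ = φ
pairSum^ (suc n) φ = pairSum^ n (pairSum φ)

binomialSum : ℕ → (ℕ → ℤ) → ℤ
binomialSum n φ = sumBelow (suc n) (λ j → + (n C j) ℤ.* φ j)

binomialSum-cong : ∀ n {φ ψ} → (∀ j → φ j ≡ ψ j) → binomialSum n φ ≡ binomialSum n ψ
binomialSum-cong n eq = sumBelow-cong (suc n) (λ j _ → cong (ℤ._*_ (+ (n C j))) (eq j))

binomialSum-+ : ∀ n φ ψ → binomialSum n (λ j → φ j ℤ.+ ψ j) ≡ binomialSum n φ ℤ.+ binomialSum n ψ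
binomialSum-+ n φ ψ = trans (sumBelow-cong (suc n) (λ j _ → ℤP.*-distribˡ-+ (+ (n C j)) (φ j) (ψ j)))
                            (sumBelow-+ (suc n) _ _)

binomialSum-pascal : ∀ n φ → binomialSum (suc n) φ ≡ binomialSum n φ ℤ.+ binomialSum n (λ j → φ (suc j))
binomialSum-pascal n φ = begin
  binomialSum (suc n) φ
    ≡⟨ sumBelow-suc (suc n) _ ⟩
  head ℤ.+ sumBelow (suc n) (λ j → + (suc n C suc j) ℤ.* φ (suc j))
    ≡⟨ cong (ℤ._+_ head) (trans (sumBelow-cong (suc n) (λ j _ → split-weight j)) (sumBelow-+ (suc n) _ _)) ⟩
  head ℤ.+ (binomialSum n (λ j → φ (suc j)) ℤ.+ rest)
    ≡⟨ regroup head (binomialSum n (λ j → φ (suc j))) rest ⟩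
  (head ℤ.+ rest) ℤ.+ binomialSum n (λ j → φ (suc j))
    ≡⟨ cong (ℤ._+ binomialSum n (λ j → φ (suc j))) (sym head+rest) ⟩
  binomialSum n φ ℤ.+ binomialSum n (λ j → φ (suc j)) ∎
  where
  head = + (n C 0) ℤ.* φ 0
  rest = sumBelow (suc n) (λ j → + (n C suc j) ℤ.* φ (suc j))
  split-weight : ∀ j → + (suc n C suc j) ℤ.* φ (suc j) ≡ + (n C j) ℤ.* φ (suc j) ℤ.+ + (n C suc j) ℤ.* φ (suc j)
  split-weight j = trans (cong (λ c → + c ℤ.* φ (suc j)) (pascal n j))
                         (trans (cong (ℤ._* φ (suc j)) (ℤP.pos-+ (n C j) (n C suc j)))
                                (ℤP.*-distribʳ-+ (φ (suc j)) (+ (n C j)) (+ (n C suc j))))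
  regroup : ∀ a b c → a ℤ.+ (b ℤ.+ c) ≡ (a ℤ.+ c) ℤ.+ b
  regroup = ℤSolver.solve-∀
  top-vanishes : + (n C suc n) ℤ.* φ (suc n) ≡ 0ℤ
  top-vanishes = cong (λ c → + c ℤ.* φ (suc n)) (k>n⇒nCk≡0 (ℕP.n<1+n n))
  head+rest : binomialSum n φ ≡ head ℤ.+ rest
  head+rest = begin
    binomialSum n φ
      ≡⟨ sumBelow-suc n _ ⟩
    head ℤ.+ sumBelow n (λ j → + (n C suc j) ℤ.* φ (suc j))
      ≡⟨ cong (ℤ._+_ head) (sym (trans (cong (ℤ._+_ (sumBelow n _)) top-vanishes) (ℤP.+-identityʳ _))) ⟩
    head ℤ.+ rest ∎

pairSum^-binomial : ∀ n φ t → pairSum^ n φ t ≡ binomialSum n (λ j → φ (t + j))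
pairSum^-binomial zero    φ t =
  sym (trans (ℤP.+-identityˡ _) (trans (ℤP.*-identityˡ _) (cong φ (ℕP.+-identityʳ t))))
pairSum^-binomial (suc n) φ t = begin
  pairSum^ n (pairSum φ) t
    ≡⟨ pairSum^-binomial n (pairSum φ) t ⟩
  binomialSum n (λ j → φ (t + j) ℤ.+ φ (suc (t + j)))
    ≡⟨ binomialSum-+ n _ _ ⟩
  binomialSum n (λ j → φ (t + j)) ℤ.+ binomialSum n (λ j → φ (suc (t + j)))
    ≡⟨ cong (ℤ._+_ (binomialSum n _)) (binomialSum-cong n (λ j → cong φ (sym (ℕP.+-suc t j)))) ⟩
  binomialSum n (λ j → φ (t + j)) ℤ.+ binomialSum n (λ j → φ (t + suc j))
    ≡⟨ sym (binomialSum-pascal n (λ j → φ (t + j))) ⟩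
  binomialSum (suc n) (λ j → φ (t + j)) ∎

f≡pairSum^ : ∀ m n → f m n ≡ pairSum^ n (λ j → sign (j C m)) 0
f≡pairSum^ m n = trans (sumTo≡sumBelow n _) (sym (pairSum^-binomial n (λ j → sign (j C m)) 0))

pairSum^-distrib-+ : ∀ n φ ψ t → pairSum^ n (λ u → φ u ℤ.+ ψ u) t ≡ pairSum^ n φ t ℤ.+ pairSum^ n ψ t
pairSum^-distrib-+ n φ ψ t = begin
  pairSum^ n (λ u → φ u ℤ.+ ψ u) t                            ≡⟨ pairSum^-binomial n _ t ⟩
  binomialSum n (λ j → φ (t + j) ℤ.+ ψ (t + j))               ≡⟨ binomialSum-+ n _ _ ⟩
  binomialSum n (λ j → φ (t + j)) ℤ.+ binomialSum n (λ j → ψ (t + j))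
    ≡⟨ sym (cong₂ ℤ._+_ (pairSum^-binomial n φ t) (pairSum^-binomial n ψ t)) ⟩
  pairSum^ n φ t ℤ.+ pairSum^ n ψ t                           ∎

pairSum^-cong : ∀ n {φ ψ} → (∀ u → φ u ≡ ψ u) → ∀ t → pairSum^ n φ t ≡ pairSum^ n ψ t
pairSum^-cong n {φ} {ψ} eq t = begin
  pairSum^ n φ t                   ≡⟨ pairSum^-binomial n φ t ⟩
  binomialSum n (λ j → φ (t + j))  ≡⟨ binomialSum-cong n (λ j → eq (t + j)) ⟩
  binomialSum n (λ j → ψ (t + j))  ≡⟨ sym (pairSum^-binomial n ψ t) ⟩
  pairSum^ n ψ t                   ∎

pairSum^-const : ∀ n c t → pairSum^ n (λ _ → c) t ≡ + (2 ^ n) ℤ.* c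
pairSum^-const zero    c t = sym (ℤP.*-identityˡ c)
pairSum^-const (suc n) c t = begin
  pairSum^ n (λ _ → c ℤ.+ c) t      ≡⟨ pairSum^-const n (c ℤ.+ c) t ⟩
  + (2 ^ n) ℤ.* (c ℤ.+ c)           ≡⟨ regroup (+ (2 ^ n)) c ⟩
  (+ 2 ℤ.* + (2 ^ n)) ℤ.* c         ≡⟨ cong (ℤ._* c) (sym (ℤP.pos-* 2 (2 ^ n))) ⟩
  + (2 ^ suc n) ℤ.* c               ∎
  where
  regroup : ∀ a c → a ℤ.* (c ℤ.+ c) ≡ (+ 2 ℤ.* a) ℤ.* c
  regroup = ℤSolver.solve-∀

pairSum^-split : ∀ m n φ → pairSum^ (m + n) φ ≡ pairSum^ n (pairSum^ m φ)
pairSum^-split zero    n φ = refl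
pairSum^-split (suc m) n φ = pairSum^-split m n (pairSum φ)

pairSum^-prefixSums-zero : ∀ φ → pairSum^ 1 (λ t → sumBelow t φ) 0 ≡ φ 0
pairSum^-prefixSums-zero φ = trans (ℤP.+-identityˡ (0ℤ ℤ.+ φ 0)) (ℤP.+-identityˡ (φ 0))

-- Since sumBelow (suc t) φ = sumBelow t φ + φ t, one more pairing doubles and adds the row of φ.
pairSum^-prefixSums-suc : ∀ φ N → pairSum^ (suc (suc N)) (λ t → sumBelow t φ) 0
                          ≡ pairSum^ (suc N) (λ t → sumBelow t φ) 0
                            ℤ.+ (pairSum^ (suc N) (λ t → sumBelow t φ) 0 ℤ.+ pairSum^ (suc N) φ 0)
pairSum^-prefixSums-suc φ N =
  trans (pairSum^-distrib-+ (suc N) (λ t → sumBelow t φ) (λ t → sumBelow t φ ℤ.+ φ t) 0)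
        (cong (ℤ._+_ (pairSum^ (suc N) (λ t → sumBelow t φ) 0)) (pairSum^-distrib-+ (suc N) (λ t → sumBelow t φ) φ 0))

pairSum^-zeroWindowSums : ∀ n r ψ → ZeroWindowSums n ψ → ZeroWindowSums n (pairSum^ r ψ)
pairSum^-zeroWindowSums n zero    ψ zero-windows = zero-windows
pairSum^-zeroWindowSums n (suc r) ψ zero-windows = pairSum^-zeroWindowSums n r (pairSum ψ) pairSum-windows
  where
  pairSum-windows : ZeroWindowSums n (pairSum ψ)
  pairSum-windows t = begin
    sumBelow n (λ i → ψ (t + i) ℤ.+ ψ (suc t + i))                     ≡⟨ sumBelow-+ n _ _ ⟩
    sumBelow n (λ i → ψ (t + i)) ℤ.+ sumBelow n (λ i → ψ (suc t + i))  ≡⟨ cong₂ ℤ._+_ (zero-windows t) (zero-windows (suc t)) ⟩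
    0ℤ                                                                  ∎

pairSum^-bounded : ∀ r ψ m → Bounded m ψ → Bounded (2 ^ r * m) (pairSum^ r ψ)
pairSum^-bounded zero    ψ m bound t = subst (ℤ.∣ ψ t ∣ ≤_) (sym (ℕP.+-identityʳ m)) (bound t)
pairSum^-bounded (suc r) ψ m bound t =
  subst (ℤ.∣ pairSum^ (suc r) ψ t ∣ ≤_) (regroup (2 ^ r) m)
    (pairSum^-bounded r (pairSum ψ) (m + m) pairSum-bounded t)
  where
  pairSum-bounded : Bounded (m + m) (pairSum ψ)
  pairSum-bounded u = ℕP.≤-trans (ℤP.∣i+j∣≤∣i∣+∣j∣ (ψ u) (ψ (suc u))) (ℕP.+-mono-≤ (bound u) (bound (suc u)))
  regroup : ∀ a m → a * (m + m) ≡ 2 * a * m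
  regroup = ℕSolver.solve-∀

sumBelowℕ : ℕ → (ℕ → ℕ) → ℕ
sumBelowℕ zero    a = 0
sumBelowℕ (suc n) a = sumBelowℕ n a + a n

sumBelow-pos : ∀ n a → sumBelow n (λ i → + a i) ≡ + sumBelowℕ n a
sumBelow-pos zero    a = refl
sumBelow-pos (suc n) a = trans (cong (ℤ._+ + a n) (sumBelow-pos n a)) (sym (ℤP.pos-+ (sumBelowℕ n a) (a n)))

∣sumBelow-*∣≤ : ∀ n (a : ℕ → ℕ) (φ : ℕ → ℤ) m → (∀ i → ℤ.∣ φ i ∣ ≤ m) → ℤ.∣ sumBelow n (λ i → + a i ℤ.* φ i) ∣ ≤ sumBelowℕ n a * m
∣sumBelow-*∣≤ zero    a φ m bound = z≤n
∣sumBelow-*∣≤ (suc n) a φ m bound =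
  ℕP.≤-trans (ℤP.∣i+j∣≤∣i∣+∣j∣ S (+ a n ℤ.* φ n))
    (subst₂ (λ x y → ℤ.∣ S ∣ + x ≤ y) (sym (ℤP.∣i*j∣≡∣i∣*∣j∣ (+ a n) (φ n))) (sym (ℕP.*-distribʳ-+ m (sumBelowℕ n a) (a n)))
      (ℕP.+-mono-≤ (∣sumBelow-*∣≤ n a φ m bound) (ℕP.*-monoʳ-≤ (a n) (bound n))))
  where
  S = sumBelow n (λ i → + a i ℤ.* φ i)

1≤nCk : ∀ {n k} → k ≤ n → 1 ≤ n C k
1≤nCk {n}     {zero}  _         = ℕP.≤-refl
1≤nCk {suc n} {suc k} (s≤s k≤n) =
  subst (1 ≤_) (sym (pascal n k)) (ℕP.≤-trans (1≤nCk k≤n) (ℕP.m≤m+n (n C k) (n C suc k)))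

+[nCk∸1]+1≡+nCk : ∀ {n k} → k ≤ n → + (n C k ∸ 1) ℤ.+ 1ℤ ≡ + (n C k)
+[nCk∸1]+1≡+nCk k≤n = trans (sym (ℤP.pos-+ _ 1)) (cong +_ (ℕP.m∸n+n≡m (1≤nCk k≤n)))

excess : ℕ → ℕ
excess L = sumBelowℕ (suc L) (λ j → L C j ∸ 1)

excess+suc≡2^ : ∀ L → excess L + suc L ≡ 2 ^ L
excess+suc≡2^ L = ℤP.+-injective (begin
  + (excess L + suc L)
    ≡⟨ ℤP.pos-+ (excess L) (suc L) ⟩
  + excess L ℤ.+ + suc L
    ≡⟨ sym (cong₂ ℤ._+_ (sumBelow-pos (suc L) _) (sumBelow-ones (suc L) (λ _ → 1ℤ) (λ _ _ → refl))) ⟩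
  sumBelow (suc L) (λ j → + (L C j ∸ 1)) ℤ.+ sumBelow (suc L) (λ _ → 1ℤ)
    ≡⟨ sym (sumBelow-+ (suc L) _ _) ⟩
  sumBelow (suc L) (λ j → + (L C j ∸ 1) ℤ.+ 1ℤ)
    ≡⟨ sumBelow-cong (suc L) (λ j j<1+L → trans (+[nCk∸1]+1≡+nCk (ℕP.≤-pred j<1+L)) (sym (ℤP.*-identityʳ _))) ⟩
  binomialSum L (λ _ → 1ℤ)
    ≡⟨ sym (pairSum^-binomial L (λ _ → 1ℤ) 0) ⟩
  pairSum^ L (λ _ → 1ℤ) 0
    ≡⟨ pairSum^-const L 1ℤ 0 ⟩
  + (2 ^ L) ℤ.* 1ℤ
    ≡⟨ ℤP.*-identityʳ _ ⟩
  + (2 ^ L) ∎)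

contraction : ∀ L ψ m → ZeroWindowSums (suc L) ψ → Bounded m ψ → Bounded (excess L * m) (pairSum^ L ψ)
contraction L ψ m zero-windows bound t =
  subst (λ z → ℤ.∣ z ∣ ≤ excess L * m) (sym reweighted)
    (∣sumBelow-*∣≤ (suc L) (λ j → L C j ∸ 1) (λ j → ψ (t + j)) m (λ j → bound (t + j)))
  where
  reduced = sumBelow (suc L) (λ j → + (L C j ∸ 1) ℤ.* ψ (t + j))
  reweight : ∀ j → j < suc L → + (L C j) ℤ.* ψ (t + j) ≡ + (L C j ∸ 1) ℤ.* ψ (t + j) ℤ.+ ψ (t + j)
  reweight j j<1+L = begin
    + (L C j) ℤ.* ψ (t + j)
      ≡⟨ cong (ℤ._* ψ (t + j)) (sym (+[nCk∸1]+1≡+nCk (ℕP.≤-pred j<1+L))) ⟩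
    (+ (L C j ∸ 1) ℤ.+ 1ℤ) ℤ.* ψ (t + j)
      ≡⟨ ℤP.*-distribʳ-+ (ψ (t + j)) (+ (L C j ∸ 1)) 1ℤ ⟩
    + (L C j ∸ 1) ℤ.* ψ (t + j) ℤ.+ 1ℤ ℤ.* ψ (t + j)
      ≡⟨ cong (ℤ._+_ (+ (L C j ∸ 1) ℤ.* ψ (t + j))) (ℤP.*-identityˡ (ψ (t + j))) ⟩
    + (L C j ∸ 1) ℤ.* ψ (t + j) ℤ.+ ψ (t + j) ∎
  reweighted : pairSum^ L ψ t ≡ reduced
  reweighted = begin
    pairSum^ L ψ t                                     ≡⟨ pairSum^-binomial L ψ t ⟩
    binomialSum L (λ j → ψ (t + j))                    ≡⟨ sumBelow-cong (suc L) reweight ⟩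
    sumBelow (suc L) (λ j → + (L C j ∸ 1) ℤ.* ψ (t + j) ℤ.+ ψ (t + j))
                                                       ≡⟨ sumBelow-+ (suc L) _ _ ⟩
    reduced ℤ.+ sumBelow (suc L) (λ j → ψ (t + j))     ≡⟨ cong (ℤ._+_ reduced) (zero-windows t) ⟩
    reduced ℤ.+ 0ℤ                                     ≡⟨ ℤP.+-identityʳ reduced ⟩
    reduced                                            ∎

pairSum^-decay : ∀ L q r ψ m → ZeroWindowSums (suc L) ψ → Bounded m ψ →
                 Bounded (excess L ^ q * (2 ^ r * m)) (pairSum^ (r + q * L) ψ)
pairSum^-decay L q r ψ m zero-windows bound t =
  subst (λ φ → ℤ.∣ φ t ∣ ≤ excess L ^ q * (2 ^ r * m)) (sym (pairSum^-split r (q * L) ψ))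
    (blocks q (pairSum^ r ψ) (2 ^ r * m) (pairSum^-zeroWindowSums (suc L) r ψ zero-windows)
       (pairSum^-bounded r ψ m bound) t)
  where
  blocks : ∀ q ψ m → ZeroWindowSums (suc L) ψ → Bounded m ψ → Bounded (excess L ^ q * m) (pairSum^ (q * L) ψ)
  blocks zero    ψ m _            bound u = subst (ℤ.∣ ψ u ∣ ≤_) (sym (ℕP.+-identityʳ m)) (bound u)
  blocks (suc q) ψ m zero-windows bound u =
    subst₂ (λ φ b → ℤ.∣ φ u ∣ ≤ b) (sym (pairSum^-split L (q * L) ψ)) (regroup (excess L ^ q) (excess L) m)
      (blocks q (pairSum^ L ψ) (excess L * m) (pairSum^-zeroWindowSums (suc L) L ψ zero-windows)
         (contraction L ψ m zero-windows bound) u)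
    where
    regroup : ∀ a c m → a * (c * m) ≡ c * a * m
    regroup = ℕSolver.solve-∀

q*c^q≤c*b^q : ∀ c b q → c < b → q * c ^ q ≤ c * b ^ q
q*c^q≤c*b^q c b zero    c<b = z≤n
q*c^q≤c*b^q c b (suc q) c<b =
  ℕP.≤-trans (ℕP.≤-reflexive (expand c (c ^ q) q))
    (ℕP.≤-trans (ℕP.+-mono-≤ (ℕP.*-monoʳ-≤ c (ℕP.^-monoˡ-≤ q (ℕP.<⇒≤ c<b)))
                             (ℕP.*-monoʳ-≤ c (q*c^q≤c*b^q c b q c<b)))
      (subst (_≤ c * (b * b ^ q)) (collect c (b ^ q)) (ℕP.*-monoʳ-≤ c (ℕP.*-monoˡ-≤ (b ^ q) c<b))))
  where
  expand : ∀ c x q → suc q * (c * x) ≡ c * x + c * (q * x)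
  expand = ℕSolver.solve-∀
  collect : ∀ c y → c * (suc c * y) ≡ c * y + c * (c * y)
  collect = ℕSolver.solve-∀

T*c^q<b^q : ∀ T c b q → c < b → T * c < q → T * c ^ q < b ^ q
T*c^q<b^q T c b q c<b T*c<q = ℕP.*-cancelʳ-< q (T * c ^ q) (b ^ q)
  (ℕP.≤-<-trans (ℕP.≤-reflexive (regroup T (c ^ q) q))
    (ℕP.≤-<-trans (ℕP.*-monoʳ-≤ T (q*c^q≤c*b^q c b q c<b))
      (subst₂ _<_ (ℕP.*-assoc T c (b ^ q)) (ℕP.*-comm q (b ^ q)) (ℕP.*-monoˡ-< (b ^ q) T*c<q))))
  where
  instance
    _ = ℕ.>-nonZero (ℕP.≤-trans (s≤s z≤n) c<b)
    _ = ℕP.m^n≢0 b q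
  regroup : ∀ T x q → T * x * q ≡ T * (q * x)
  regroup = ℕSolver.solve-∀

pairSum^-negligible : ∀ L .{{_ : NonZero L}} ψ m → ZeroWindowSums (suc L) ψ → Bounded m ψ →
                      ∀ T → ∃[ n₀ ] (∀ n → n ≥ n₀ → ℤ.∣ pairSum^ n ψ 0 ∣ * T < 2 ^ n)
pairSum^-negligible L ψ m zero-windows bound T = suc (T * m * c) * L , small
  where
  c = excess L
  c<2^L : c < 2 ^ L
  c<2^L = subst (suc c ≤_) (trans (sym (ℕP.+-suc c L)) (excess+suc≡2^ L)) (s≤s (ℕP.m≤m+n c L))
  small : ∀ n → n ≥ suc (T * m * c) * L → ℤ.∣ pairSum^ n ψ 0 ∣ * T < 2 ^ n
  small n n≥n₀ = ℕP.≤-<-trans (ℕP.*-monoˡ-≤ T decay)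
    (subst₂ _<_ (regroup (2 ^ r) (c ^ q) m T) 2^r*[2^L]^q≡2^n (ℕP.*-monoʳ-< (2 ^ r) {{ℕP.m^n≢0 2 r}} geometric))
    where
    q = n / L
    r = n % L
    n≡r+q*L = m≡m%n+[m/n]*n n L
    q-large : T * m * c < q
    q-large = subst (_≤ q) (m*n/n≡m (suc (T * m * c)) L) (/-monoˡ-≤ L n≥n₀)
    decay : ℤ.∣ pairSum^ n ψ 0 ∣ ≤ c ^ q * (2 ^ r * m)
    decay = subst (λ k → ℤ.∣ pairSum^ k ψ 0 ∣ ≤ c ^ q * (2 ^ r * m)) (sym n≡r+q*L)
              (pairSum^-decay L q r ψ m zero-windows bound 0)
    geometric : T * m * c ^ q < (2 ^ L) ^ q
    geometric = T*c^q<b^q (T * m) c (2 ^ L) q c<2^L q-large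
    2^r*[2^L]^q≡2^n : 2 ^ r * (2 ^ L) ^ q ≡ 2 ^ n
    2^r*[2^L]^q≡2^n = begin
      2 ^ r * (2 ^ L) ^ q   ≡⟨ cong (2 ^ r *_) (trans (ℕP.^-*-assoc 2 L q) (cong (2 ^_) (ℕP.*-comm L q))) ⟩
      2 ^ r * 2 ^ (q * L)   ≡⟨ sym (ℕP.^-distribˡ-+-* 2 r (q * L)) ⟩
      2 ^ (r + q * L)       ≡⟨ cong (2 ^_) (sym n≡r+q*L) ⟩
      2 ^ n                 ∎
    regroup : ∀ R x m T → R * (T * m * x) ≡ x * (R * m) * T
    regroup = ℕSolver.solve-∀

-- Dyadic partial sums

-- mkℚᵘ z d denotes z / (d + 1), so the denominator 2^n is encoded by mersenne n = 2^n - 1.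
mersenne : ℕ → ℕ
mersenne zero    = 0
mersenne (suc n) = suc (mersenne n + mersenne n)

suc-mersenne : ∀ n → suc (mersenne n) ≡ 2 ^ n
suc-mersenne zero    = refl
suc-mersenne (suc n) = begin
  suc (suc (mersenne n + mersenne n))  ≡⟨ sym (double-suc (mersenne n)) ⟩
  suc (mersenne n) + suc (mersenne n)  ≡⟨ cong (λ m → m + m) (suc-mersenne n) ⟩
  2 ^ n + 2 ^ n                        ≡⟨ sym (2^[1+k]≡2^k+2^k n) ⟩
  2 ^ suc n                            ∎

toℚᵘ-toℚ : ∀ z → toℚᵘ (toℚ z) ≃ mkℚᵘ z 0
toℚᵘ-toℚ z = ℚP.toℚᵘ-fromℚᵘ (mkℚᵘ z 0)

toℚᵘ-halfPow : ∀ n → toℚᵘ (halfPow n) ≃ mkℚᵘ 1ℤ (mersenne n)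
toℚᵘ-halfPow zero    = ℚᵘP.≃-refl
toℚᵘ-halfPow (suc n) =
  ℚᵘP.≃-trans (ℚP.toℚᵘ-homo-* ℚ.½ (halfPow n))
    (ℚᵘP.≃-trans (ℚᵘP.*-congˡ {mkℚᵘ 1ℤ 1} (toℚᵘ-halfPow n)) (*≡* (cong ℤ.+[1+_] (denominators (mersenne n)))))
  where
  denominators : ∀ D → suc (D + D + 0 * suc (suc (D + D))) ≡ D + 1 * suc D + 0 * suc (D + 1 * suc D)
  denominators = ℕSolver.solve-∀

toℚᵘ-dyadic : ∀ z n → toℚᵘ (toℚ z ℚ.* halfPow n) ≃ mkℚᵘ z (mersenne n)
toℚᵘ-dyadic z n =
  ℚᵘP.≃-trans (ℚP.toℚᵘ-homo-* (toℚ z) (halfPow n))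
    (ℚᵘP.≃-trans (ℚᵘP.*-cong (toℚᵘ-toℚ z) (toℚᵘ-halfPow n)) (*≡* (cong₂ ℤ._*_ (ℤP.*-identityʳ z) (cong ℤ.+[1+_] (sym (ℕP.+-identityʳ (mersenne n)))))))

dyadic-step : ∀ i z D → mkℚᵘ i D ℚᵘ.+ mkℚᵘ z (suc (D + D)) ≃ mkℚᵘ (i ℤ.+ (i ℤ.+ z)) (suc (D + D))
dyadic-step i z D = *≡* (begin
  (i ℤ.* e ℤ.+ z ℤ.* b) ℤ.* e                ≡⟨ cong (λ x → (i ℤ.* x ℤ.+ z ℤ.* b) ℤ.* x) e≡b+b ⟩
  (i ℤ.* (b ℤ.+ b) ℤ.+ z ℤ.* b) ℤ.* (b ℤ.+ b) ≡⟨ regroup i z b ⟩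
  (i ℤ.+ (i ℤ.+ z)) ℤ.* (b ℤ.* (b ℤ.+ b))    ≡⟨ cong (λ x → (i ℤ.+ (i ℤ.+ z)) ℤ.* (b ℤ.* x)) (sym e≡b+b) ⟩
  (i ℤ.+ (i ℤ.+ z)) ℤ.* (b ℤ.* e)            ≡⟨ cong (ℤ._*_ (i ℤ.+ (i ℤ.+ z))) (sym (ℤP.pos-* (suc D) (suc (suc (D + D))))) ⟩
  (i ℤ.+ (i ℤ.+ z)) ℤ.* + (suc D * suc (suc (D + D))) ∎)
  where
  b = + suc D
  e = + suc (suc (D + D))
  e≡b+b : e ≡ b ℤ.+ b
  e≡b+b = trans (cong +_ (sym (double-suc D))) (ℤP.pos-+ (suc D) (suc D))
  regroup : ∀ i z b → (i ℤ.* (b ℤ.+ b) ℤ.+ z ℤ.* b) ℤ.* (b ℤ.+ b) ≡ (i ℤ.+ (i ℤ.+ z)) ℤ.* (b ℤ.* (b ℤ.+ b))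
  regroup = ℤSolver.solve-∀

toℚᵘ-partialSum : ∀ (F I : ℕ → ℤ) → I 0 ≡ F 0 → (∀ N → I (suc N) ≡ I N ℤ.+ (I N ℤ.+ F (suc N))) →
                  ∀ N → toℚᵘ (partialSum (λ n → toℚ (F n) ℚ.* halfPow n) N) ≃ mkℚᵘ (I N) (mersenne N)
toℚᵘ-partialSum F I I-zero I-suc zero =
  ℚᵘP.≃-trans (toℚᵘ-dyadic (F 0) 0) (ℚᵘP.≃-reflexive (cong (λ z → mkℚᵘ z 0) (sym I-zero)))
toℚᵘ-partialSum F I I-zero I-suc (suc N) =
  ℚᵘP.≃-trans (ℚP.toℚᵘ-homo-+ (partialSum a N) (a (suc N)))
    (ℚᵘP.≃-trans (ℚᵘP.+-cong (toℚᵘ-partialSum F I I-zero I-suc N) (toℚᵘ-dyadic (F (suc N)) (suc N)))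
      (ℚᵘP.≃-trans (dyadic-step (I N) (F (suc N)) (mersenne N))
        (ℚᵘP.≃-reflexive (cong (λ z → mkℚᵘ z (mersenne (suc N))) (sym (I-suc N))))))
  where
  a : ℕ → ℚ
  a n = toℚ (F n) ℚ.* halfPow n

toℚᵘ-sub-toℚ : ∀ x X k D → toℚᵘ x ≃ mkℚᵘ (X ℤ.+ + suc D ℤ.* k) D → toℚᵘ (x ℚ.- toℚ k) ≃ mkℚᵘ X D
toℚᵘ-sub-toℚ x X k D x≃ =
  ℚᵘP.≃-trans (ℚP.toℚᵘ-homo-+ x (ℚ.- toℚ k))
    (ℚᵘP.≃-trans (ℚᵘP.+-cong x≃ (ℚᵘP.≃-trans (ℚP.toℚᵘ-homo‿- (toℚ k)) (ℚᵘP.-‿cong (toℚᵘ-toℚ k))))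
      (*≡* (trans (regroup X k (+ suc D)) (cong (ℤ._*_ X) (sym (ℤP.pos-* (suc D) 1))))))
  where
  regroup : ∀ X k b → ((X ℤ.+ b ℤ.* k) ℤ.* 1ℤ ℤ.+ ℤ.- k ℤ.* b) ℤ.* b ≡ X ℤ.* (b ℤ.* 1ℤ)
  regroup = ℤSolver.solve-∀

cross-mul⇒∣x∣<ε : ∀ x X D ε p d → toℚᵘ x ≃ mkℚᵘ X D → toℚᵘ ε ≡ mkℚᵘ ℤ.+[1+ p ] d →
              ℤ.∣ X ∣ * suc d < suc p * suc D → ℚ.∣ x ∣ ℚ.< ε
cross-mul⇒∣x∣<ε x X D ε p d x≃ ε≡ lt = ℚP.toℚᵘ-cancel-<
  (subst (toℚᵘ ℚ.∣ x ∣ ℚᵘ.<_) (sym ε≡)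
    (ℚᵘP.<-respˡ-≃ (ℚᵘP.≃-sym (ℚᵘP.≃-trans (ℚP.toℚᵘ-homo-∣-∣ x) (ℚᵘP.∣-∣-cong x≃)))
      (ℚᵘ.*<* (subst₂ ℤ._<_ (ℤP.pos-* ℤ.∣ X ∣ (suc d)) (ℤP.pos-* (suc p) (suc D)) (ℤ.+<+ lt)))))

positive⇒mkℚᵘ : ∀ ε → ℚ.0ℚ ℚ.< ε → ∃[ p ] ∃[ d ] toℚᵘ ε ≡ mkℚᵘ ℤ.+[1+ p ] d
positive⇒mkℚᵘ (ℚ.mkℚ ℤ.+[1+ p ] d _) _                  = p , d , refl
positive⇒mkℚᵘ (ℚ.mkℚ (+ 0)      d _) (ℚ.*<* (ℤ.+<+ ()))
positive⇒mkℚᵘ (ℚ.mkℚ ℤ.-[1+ n ] d _) (ℚ.*<* ())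

module SignedBinomials (k : ℕ) where

  K half : ℕ
  K    = 2 ^ suc k
  half = 2 ^ k

  instance
    K≢0 : NonZero K
    K≢0 = ℕP.m^n≢0 2 (suc k)

  g : ℕ → ℤ
  g j = sign (j C K)

  G : ℕ → ℤ
  G t = sumBelow t g

  H : ℕ → ℤ
  H t = G t ℤ.- + half

  G-shift : ∀ t → G (t + K) ≡ + K ℤ.- G t
  G-shift t = trans (sumBelow-antiperiodic K g (sign-C-2^-antiperiodic (suc k)) t)
                    (cong (ℤ._- G t) (sumBelow-ones K g (sign-C-2^-below (suc k))))

  H-antiperiodic : Antiperiodic K H
  H-antiperiodic t = begin
    G (t + K) ℤ.- + half                        ≡⟨ cong (ℤ._- + half) (G-shift t) ⟩
    (+ K ℤ.- G t) ℤ.- + half                    ≡⟨ cong (λ x → (x ℤ.- G t) ℤ.- + half) K≡half+half ⟩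
    ((+ half ℤ.+ + half) ℤ.- G t) ℤ.- + half    ≡⟨ regroup (+ half) (G t) ⟩
    ℤ.- (G t ℤ.- + half)                        ∎
    where
    K≡half+half : + K ≡ + half ℤ.+ + half
    K≡half+half = trans (cong +_ (2^[1+k]≡2^k+2^k k)) (ℤP.pos-+ half half)
    regroup : ∀ h x → ((h ℤ.+ h) ℤ.- x) ℤ.- h ≡ ℤ.- (x ℤ.- h)
    regroup = ℤSolver.solve-∀

  H-bounded : Bounded (K + half) H
  H-bounded = antiperiodic-bounded K H (K + half) H-antiperiodic below
    where
    below : ∀ r → r < K → ℤ.∣ H r ∣ ≤ K + half
    below r r<K = subst (λ x → ℤ.∣ x ℤ.- + half ∣ ≤ K + half)
      (sym (sumBelow-ones r g (λ i i<r → sign-C-2^-below (suc k) i (ℕP.<-trans i<r r<K))))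
      (ℕP.≤-trans (ℤP.∣i-j∣≤∣i∣+∣j∣ (+ r) (+ half)) (ℕP.+-monoˡ-≤ half (ℕP.<⇒≤ r<K)))

  L : ℕ
  L = K + ℕ.pred K

  instance
    L≢0 : NonZero L
    L≢0 = ℕ.>-nonZero (ℕP.<-≤-trans (ℕP.m^n>0 2 (suc k)) (ℕP.m≤m+n K (ℕ.pred K)))

  H-zeroWindowSums : ZeroWindowSums (suc L) H
  H-zeroWindowSums = subst (λ n → ZeroWindowSums n H) K+K≡suc-L (antiperiodic⇒zeroWindowSums K H H-antiperiodic)
    where
    K+K≡suc-L : K + K ≡ suc L
    K+K≡suc-L = trans (cong (_+_ K) (sym (ℕP.suc-pred K))) (ℕP.+-suc K (ℕ.pred K))

  I X : ℕ → ℤ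
  I N = pairSum^ (suc N) G 0
  X N = pairSum^ (suc N) H 0

  I-zero : I 0 ≡ f K 0
  I-zero = trans (pairSum^-prefixSums-zero g) (sym (ℤP.*-identityˡ (g 0)))

  I-suc : ∀ N → I (suc N) ≡ I N ℤ.+ (I N ℤ.+ f K (suc N))
  I-suc N = trans (pairSum^-prefixSums-suc g N)
                  (cong (λ z → I N ℤ.+ (I N ℤ.+ z)) (sym (f≡pairSum^ K (suc N))))

  I≡X+2^N*K : ∀ N → I N ≡ X N ℤ.+ + (2 ^ N) ℤ.* + K
  I≡X+2^N*K N = begin
    I N                                          ≡⟨ pairSum^-cong (suc N) (λ t → recenter (G t) (+ half)) 0 ⟩
    pairSum^ (suc N) (λ t → H t ℤ.+ + half) 0    ≡⟨ pairSum^-distrib-+ (suc N) H (λ _ → + half) 0 ⟩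
    X N ℤ.+ pairSum^ (suc N) (λ _ → + half) 0    ≡⟨ cong (ℤ._+_ (X N)) (pairSum^-const (suc N) (+ half) 0) ⟩
    X N ℤ.+ + (2 ^ suc N) ℤ.* + half             ≡⟨ cong (ℤ._+_ (X N)) 2^[1+N]*half≡2^N*K ⟩
    X N ℤ.+ + (2 ^ N) ℤ.* + K                    ∎
    where
    recenter : ∀ x h → x ≡ (x ℤ.- h) ℤ.+ h
    recenter = ℤSolver.solve-∀
    move-2 : ∀ a b → 2 * a * b ≡ a * (2 * b)
    move-2 = ℕSolver.solve-∀
    2^[1+N]*half≡2^N*K : + (2 ^ suc N) ℤ.* + half ≡ + (2 ^ N) ℤ.* + K
    2^[1+N]*half≡2^N*K = trans (sym (ℤP.pos-* (2 ^ suc N) half))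
                              (trans (cong +_ (move-2 (2 ^ N) half)) (ℤP.pos-* (2 ^ N) K))

  partialSum-error : ∀ N → toℚᵘ (partialSum (λ n → toℚ (f K n) ℚ.* halfPow n) N ℚ.- toℚ (+ K)) ≃ mkℚᵘ (X N) (mersenne N)
  partialSum-error N = toℚᵘ-sub-toℚ _ (X N) (+ K) (mersenne N)
    (ℚᵘP.≃-trans (toℚᵘ-partialSum (f K) I I-zero I-suc N)
                 (ℚᵘP.≃-reflexive (cong (λ z → mkℚᵘ z (mersenne N)) I≡X+[1+mersenne]*K)))
    where
    I≡X+[1+mersenne]*K : I N ≡ X N ℤ.+ + suc (mersenne N) ℤ.* + K
    I≡X+[1+mersenne]*K = trans (I≡X+2^N*K N) (cong (λ n → X N ℤ.+ + n ℤ.* + K) (sym (suc-mersenne N)))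

  X-negligible : ∀ T → ∃[ N₀ ] (∀ N → N ≥ N₀ → ℤ.∣ X N ∣ * T < 2 ^ N)
  X-negligible T with pairSum^-negligible L H (K + half) H-zeroWindowSums H-bounded (2 * T)
  ... | n₀ , small = n₀ , λ N N≥n₀ → ℕP.*-cancelˡ-< 2 (ℤ.∣ X N ∣ * T) (2 ^ N)
    (subst (_< 2 ^ suc N) (regroup ℤ.∣ X N ∣ T) (small (suc N) (ℕP.m≤n⇒m≤1+n N≥n₀)))
    where
    regroup : ∀ x T → x * (2 * T) ≡ 2 * (x * T)
    regroup = ℕSolver.solve-∀

corollary5p2 : ∀ (k : ℕ) → k ≥ 1 →
    SeriesSumsTo (λ n → toℚ (f (2 ^ k) n) ℚ.* halfPow n) (toℚ (+ (2 ^ k)))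
corollary5p2 (suc k) _ ε 0<ε with positive⇒mkℚᵘ ε 0<ε
... | p , d , ε≡ = proj₁ negligible , λ N N≥N₀ →
  cross-mul⇒∣x∣<ε _ (X N) (mersenne N) ε p d (partialSum-error N) ε≡
    (subst (λ n → ℤ.∣ X N ∣ * suc d < suc p * n) (sym (suc-mersenne N))
      (ℕP.<-≤-trans (proj₂ negligible N N≥N₀) (ℕP.m≤n*m (2 ^ N) (suc p))))
  where
  open SignedBinomials k
  negligible = X-negligible (suc d)
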